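{- Let $\mathcal{G}_{12,\mathrm{tree}}$ be the set of all permutations $\pi$ such that the occurrence graph $G_{12}(\pi)$ is a tree. Then \[ \mathcal{G}_{12,\mathrm{tree}} = \mathrm{Av}(123, 1432, 2143, 3214, m)\setminus \mathrm{Av}(12), \] where $m=(3412,R)$ is the mesh pattern with underlying permutation $3412$ and shaded box set $R=\{(0,0),(0,1),(1,0),(1,1),(2,0),(2,1),(3,2),(3,3),(3,4),(4,2),(4,3),(4,4)\}$.
   Context: For a permutation $\pi$ of length $n$, $V_{12}(\pi)$ is the set of pairs $\{i,j\}$ with $1\le i<j\le n$ and $\pi(i)<\pi(j)$, and the occurrence graph $G_{12}(\pi)$ is the simple undirected graph with vertex set $V_{12}(\pi)$ in which two vertices are adjacent iff they share exactly one element. A tree is a graph with at least one vertex that is connected and has no cycles (the graph with no vertices is not a tree). A permutation $\pi$ contains a classical pattern $q$ of length $k$ if there are indices $i_1<\dots<i_k$ with $\pi(i_1)\cdots\pi(i_k)$ order-isomorphic to $q$. A mesh pattern $(\tau,R)$ consists of $\tau\in\mathfrak{S}_k$ and $R\subseteq\{0,\dots,k\}^2$; $\pi$ of length $n$ contains $(\tau,R)$ if there are indices $i_1<\dots<i_k$ with $\pi(i_1)\cdots\pi(i_k)$ order-isomorphic to $\tau$ such that, with $i_0=0$, $i_{k+1}=n+1$, $v_1<\dots<v_k$ the values $\pi(i_1),\dots,\pi(i_k)$ sorted, $v_0=0$, $v_{k+1}=n+1$, for every $(a,b)\in R$ no index $x$ satisfies $i_a<x<i_{a+1}$ and $v_b<\pi(x)<v_{b+1}$.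 $\mathrm{Av}(M)$ is the set of permutations avoiding (i.e., not containing) every pattern in $M$. -}

module Defs where

open import Data.Nat using (ℕ; zero; suc; _≥_)
open import Data.Fin using (Fin; toℕ; _<_; #_)
open import Data.Fin.Permutation using (Permutation′; _⟨$⟩ʳ_)
open import Data.Product using (Σ; ∃; ∃-syntax; _×_; _,_)
open import Data.Sum using (_⊎_)
open import Data.List using (List; []; _∷_; _++_; length)
open import Data.List.Membership.Propositional using (_∈_)
open import Data.List.Relation.Unary.All using (All)
open import Data.List.Relation.Unary.Unique.Propositional using (Unique)
open import Data.List.Relation.Unary.Linked using (Linked)
open import Data.Vec using (Vec; []; _∷_; lookup)
open import Relation.Binary.PropositionalEquality using (_≡_)
open import Relation.Nullary using (¬_)
open import Data.Empty using (⊥)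

module _ {V : Set} (InV : V → Set) (Adj : V → V → Set) where

  data Walk : V → V → Set where
    here : ∀ {u} → Walk u u
    step : ∀ {u w v} → Adj u w → InV w → Walk w v → Walk u v

  Connected : Set
  Connected = ∀ u v → InV u → InV v → Walk u v

  IsCycle : List V → Set
  IsCycle [] = ⊥
  IsCycle (v₀ ∷ rest) =
    length rest ≥ 2 × All InV (v₀ ∷ rest) × Unique (v₀ ∷ rest)
    × Linked Adj ((v₀ ∷ rest) ++ (v₀ ∷ []))

  Acyclic : Set
  Acyclic = ∀ cs → ¬ IsCycle cs

  IsTree : Set
  IsTree = (∃[ v ] InV v) × Connected × Acyclic

-- The occurrence graph G₁₂(π) (indices 0-based).
-- A vertex {i,j} (i<j) is represented by the ordered pair (i , j) with i < j.

module _ {n : ℕ} (π : Permutation′ n) where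

  V₁₂ : Fin n × Fin n → Set
  V₁₂ (i , j) = i < j × (π ⟨$⟩ʳ i) < (π ⟨$⟩ʳ j)

  -- {i,j} and {k,l} share exactly one element: they share some element,
  -- and they are not the same 2-element set (given i<j, k<l, equality
  -- of the sets means i ≡ k and j ≡ l).
  Adj₁₂ : Fin n × Fin n → Fin n × Fin n → Set
  Adj₁₂ (i , j) (k , l) =
    (i ≡ k ⊎ i ≡ l ⊎ j ≡ k ⊎ j ≡ l) × ¬ (i ≡ k × j ≡ l)

  G₁₂-isTree : Set
  G₁₂-isTree = IsTree V₁₂ Adj₁₂

-- Classical and mesh patterns. A pattern τ ∈ 𝔖_k is given by its
-- values τ : Fin k → Fin k (0-based, i.e. τ(a) = rank-1).

module _ {n : ℕ} (π : Permutation′ n) where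

  StrictlyIncreasing : {k : ℕ} → (Fin k → Fin n) → Set
  StrictlyIncreasing ι = ∀ a b → a < b → ι a < ι b

  OrderIso : {k : ℕ} → (Fin k → Fin n) → (Fin k → Fin k) → Set
  OrderIso ι τ = ∀ a b →
    ((π ⟨$⟩ʳ ι a) < (π ⟨$⟩ʳ ι b) → τ a < τ b)
    × (τ a < τ b → (π ⟨$⟩ʳ ι a) < (π ⟨$⟩ʳ ι b))

  Occurrence : {k : ℕ} → (Fin k → Fin k) → (Fin k → Fin n) → Set
  Occurrence τ ι = StrictlyIncreasing ι × OrderIso ι τ

  Contains : {k : ℕ} → (Fin k → Fin k) → Set
  Contains τ = ∃[ ι ] Occurrence τ ι

  -- Mesh conditions for an occurrence ι of τ (k = length of τ), with the
  -- paper's 1-based conventions translated:  i_a (a = 1..k) is the index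
  -- ι(a-1), i_0 = "before everything", i_{k+1} = "after everything";
  -- v_b (b = 1..k) is the b-th smallest occurrence value, i.e. π(ι c)
  -- for the c with τ c = b-1 (0-based); v_0 = -∞, v_{k+1} = +∞.
  module _ {k : ℕ} (τ : Fin k → Fin k) (ι : Fin k → Fin n) where

    -- i_a < x
    RightOf : ℕ → Fin n → Set
    RightOf a x = a ≡ 0 ⊎ ∃[ c ] (suc (toℕ c) ≡ a × ι c < x)

    -- x < i_{a+1}
    LeftOf : ℕ → Fin n → Set
    LeftOf a x = a ≡ k ⊎ ∃[ c ] (toℕ c ≡ a × x < ι c)

    -- v_b < π(x)
    Above : ℕ → Fin n → Set
    Above b x = b ≡ 0 ⊎ ∃[ c ] (suc (toℕ (τ c)) ≡ b × (π ⟨$⟩ʳ ι c) < (π ⟨$⟩ʳ x))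

    -- π(x) < v_{b+1}
    Below : ℕ → Fin n → Set
    Below b x = b ≡ k ⊎ ∃[ c ] (toℕ (τ c) ≡ b × (π ⟨$⟩ʳ x) < (π ⟨$⟩ʳ ι c))

    BoxEmpty : ℕ × ℕ → Set
    BoxEmpty (a , b) =
      ¬ (∃[ x ] (RightOf a x × LeftOf a x × Above b x × Below b x))

  ContainsMesh : {k : ℕ} → (Fin k → Fin k) → List (ℕ × ℕ) → Set
  ContainsMesh τ R =
    ∃[ ι ] (Occurrence τ ι × (∀ ab → ab ∈ R → BoxEmpty τ ι ab))

  Avoids : {k : ℕ} → (Fin k → Fin k) → Set
  Avoids τ = ¬ Contains τ

  AvoidsMesh : {k : ℕ} → (Fin k → Fin k) → List (ℕ × ℕ) → Set
  AvoidsMesh τ R = ¬ ContainsMesh τ R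

pat : {k : ℕ} → Vec (Fin k) k → Fin k → Fin k
pat v = lookup v

p12 : Fin 2 → Fin 2
p12 = pat (# 0 ∷ # 1 ∷ [])

p123 : Fin 3 → Fin 3
p123 = pat (# 0 ∷ # 1 ∷ # 2 ∷ [])

p1432 : Fin 4 → Fin 4
p1432 = pat (# 0 ∷ # 3 ∷ # 2 ∷ # 1 ∷ [])

p2143 : Fin 4 → Fin 4
p2143 = pat (# 1 ∷ # 0 ∷ # 3 ∷ # 2 ∷ [])

p3214 : Fin 4 → Fin 4
p3214 = pat (# 2 ∷ # 1 ∷ # 0 ∷ # 3 ∷ [])

p3412 : Fin 4 → Fin 4
p3412 = pat (# 2 ∷ # 3 ∷ # 0 ∷ # 1 ∷ [])

R-m : List (ℕ × ℕ)
R-m = (0 , 0) ∷ (0 , 1) ∷ (1 , 0) ∷ (1 , 1) ∷ (2 , 0) ∷ (2 , 1)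
    ∷ (3 , 2) ∷ (3 , 3) ∷ (3 , 4) ∷ (4 , 2) ∷ (4 , 3) ∷ (4 , 4) ∷ []

-- (⇒) A vertex is an occurrence of 12, and each forbidden classical pattern closes a short
-- cycle of ascents: a triangle for 123, 1432, 3214 and a square for 2143.  For an
-- occurrence l r c d of 3412 the shaded boxes of m are exactly the points left of c below
-- π(d) and right of c above π(d); if these are empty, the ascents inside the quadrant
-- {x ≥ c, π(x) ≤ π(d)} are closed under adjacency, so no walk leads from (c,d) to (l,r).
-- (⇐) Avoiding 123 makes adjacent ascents share their left or their right end, and
-- avoiding 1432 and 3214 makes these alternate along paths; in a cycle, a vertex of maximal
-- right end together with its neighbours then yields 2143.  For connectivity we walk up
-- lexicographically: from u <ₗ v some neighbour w has u <ₗ w ≤ₗ v, since the only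
-- obstruction, a "gap", produces an occurrence of m from a leftmost ascent after the gap.
module Submission where

open import Defs
open import Data.Nat as ℕ using (ℕ; zero; suc; z≤n; s≤s; _+_; _*_)
import Data.Nat.Properties as ℕ
open import Data.Fin using (Fin; zero; suc; toℕ; inject₁; _<_; _≤_; #_)
open import Data.Fin.Properties
  using (<-cmp; <-trans; <-irrefl; <-asym; <⇒≢; ≤∧≢⇒<; _≟_; _<?_; any?; all?; toℕ-injective; toℕ<n)
open import Data.Fin.Permutation using (Permutation′; _⟨$⟩ʳ_; _⟨$⟩ˡ_; inverseˡ)
open import Data.Product using (Σ; ∃; _×_; _,_; proj₁; proj₂)
open import Data.Product.Properties using (≡-dec)
open import Data.Sum using (_⊎_; inj₁; inj₂)
open import Data.Empty using (⊥; ⊥-elim)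
open import Data.List using (List; []; _∷_; _++_; _∷ʳ_; filter; allFin; initLast; _∷ʳ′_)
open import Data.List.Properties using (++-assoc; ++-identityʳ)
open import Data.List.Extrema.Nat using (argmax; argmin; argmax-sel; argmax-all; argmin-all; f[⊥]≤f[argmax]; f[xs]≤f[argmax]; f[argmin]≤f[xs])
open import Data.List.Membership.Propositional using (_∈_)
open import Data.List.Membership.Propositional.Properties using (∈-filter⁺; ∈-allFin; ∈-∃++)
open import Data.List.Membership.DecPropositional (≡-dec ℕ._≟_ ℕ._≟_) using (_∈?_)
open import Data.List.Relation.Unary.Any using (here; there)
open import Data.List.Relation.Unary.All as All using (All; []; _∷_)
open import Data.List.Relation.Unary.All.Properties using (all-filter)
open import Data.List.Relation.Unary.AllPairs using ([]; _∷_)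
open import Data.List.Relation.Unary.Linked using (Linked; [-]; _∷_)
open import Data.List.Relation.Binary.Permutation.Propositional using (_↭_; ↭⇒↭ₛ)
open import Data.List.Relation.Binary.Permutation.Propositional.Properties using (++-comm; All-resp-↭; ↭-length)
open import Data.Vec using ([]; _∷_; lookup)
open import Function using (_∘_)
open import Function.Bundles using (_⇔_; mk⇔)
open import Relation.Binary.PropositionalEquality
  using (_≡_; _≢_; refl; sym; trans; cong; cong₂; subst; subst₂; setoid)
open import Relation.Binary.Definitions using (tri<; tri≈; tri>)
open import Relation.Nullary using (¬_; Dec; yes; no)
open import Relation.Nullary.Decidable using (True; toWitness; _×-dec_; _⊎-dec_)

import Data.List.Relation.Binary.Permutation.Setoid.Properties as SetoidPermutation

module Extremal {n : ℕ} {Q : Fin n → Set} (Q? : ∀ x → Dec (Q x)) (f : Fin n → ℕ) where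

  private
    candidates : List (Fin n)
    candidates = filter Q? (allFin n)

    listed : ∀ {x} → Q x → x ∈ candidates
    listed {x} q = ∈-filter⁺ Q? (∈-allFin x) q

  maximal-witness : ∃ Q → ∃ λ m → Q m × (∀ x → Q x → f x ℕ.≤ f m)
  maximal-witness (x₀ , q₀) =
    argmax f x₀ candidates , argmax-all f q₀ (all-filter Q? (allFin n)) ,
    λ x q → All.lookup (f[xs]≤f[argmax] x₀ candidates) (listed q)

  minimal-witness : ∃ Q → ∃ λ m → Q m × (∀ x → Q x → f m ℕ.≤ f x)
  minimal-witness (x₀ , q₀) =
    argmin f x₀ candidates , argmin-all f q₀ (all-filter Q? (allFin n)) ,
    λ x q → All.lookup (f[argmin]≤f[xs] x₀ candidates) (listed q)

open Extremal using (maximal-witness; minimal-witness)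

-- A map out of Fin (suc k) that increases at every consecutive step.  (A record, so
-- that the map can be inferred from the expected type.)
record Ascending {k n : ℕ} (f : Fin (suc k) → Fin n) : Set where
  constructor ascending
  field increases : (a : Fin k) → f (inject₁ a) < f (suc a)

ascending⇒increasing : ∀ {k n} (f : Fin (suc k) → Fin n) → Ascending f →
  ∀ a b → a < b → f a < f b
ascending⇒increasing {suc k} f (ascending up) zero (suc zero) _ = up zero
ascending⇒increasing {suc k} f (ascending up) zero (suc (suc b)) _ =
  <-trans (up zero) (ascending⇒increasing (f ∘ suc) (ascending (up ∘ suc)) zero (suc b) (s≤s z≤n))
ascending⇒increasing {suc k} f (ascending up) (suc a) (suc b) (s≤s a<b) =
  ascending⇒increasing (f ∘ suc) (ascending (up ∘ suc)) a b a<b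

module _ {n : ℕ} where

  ascending₂ : {f : Fin 2 → Fin n} → f zero < f (suc zero) → Ascending f
  ascending₂ p = ascending λ { zero → p }

  ascending₃ : {f : Fin 3 → Fin n} →
    f zero < f (suc zero) → f (suc zero) < f (suc (suc zero)) → Ascending f
  ascending₃ p q = ascending λ { zero → p ; (suc zero) → q }

  ascending₄ : {f : Fin 4 → Fin n} →
    f zero < f (suc zero) → f (suc zero) < f (suc (suc zero)) →
    f (suc (suc zero)) < f (suc (suc (suc zero))) → Ascending f
  ascending₄ p q r = ascending λ { zero → p ; (suc zero) → q ; (suc (suc zero)) → r }

≢⇒<⊎> : ∀ {n} {a b : Fin n} → a ≢ b → a < b ⊎ b < a
≢⇒<⊎> {a = a} {b} a≢b with <-cmp a b
... | tri< a<b _ _ = inj₁ a<b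
... | tri≈ _ a≡b _ = ⊥-elim (a≢b a≡b)
... | tri> _ _ b<a = inj₂ b<a

no-three : ∀ {n} {Q : Fin n → Set} → (∀ {a b c} → a < b → b < c → Q a → Q b → Q c → ⊥) →
  ∀ {x y z} → x ≢ y → y ≢ z → x ≢ z → Q x → Q y → Q z → ⊥
no-three sorted x≢y y≢z x≢z qx qy qz with ≢⇒<⊎> x≢y | ≢⇒<⊎> y≢z | ≢⇒<⊎> x≢z
... | inj₁ x<y | inj₁ y<z | _        = sorted x<y y<z qx qy qz
... | inj₁ x<y | inj₂ z<y | inj₁ x<z = sorted x<z z<y qx qz qy
... | inj₁ x<y | inj₂ z<y | inj₂ z<x = sorted z<x x<y qz qx qy
... | inj₂ y<x | inj₁ y<z | inj₁ x<z = sorted y<x x<z qy qx qz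
... | inj₂ y<x | inj₁ y<z | inj₂ z<x = sorted y<z z<x qy qz qx
... | inj₂ y<x | inj₂ z<y | _        = sorted z<y y<x qz qy qx

module Graphs {V : Set} (I : V → Set) (A : V → V → Set) where

  walk-preserves : (S : V → Set) → (∀ {u w} → A u w → I w → S u → S w) →
    ∀ {u v} → Walk I A u v → S u → S v
  walk-preserves S step-S here s = s
  walk-preserves S step-S (step a i rest) s = walk-preserves S step-S rest (step-S a i s)

  reverse-walk : (∀ {u w} → A u w → A w u) → ∀ {u v} → I u → Walk I A u v → Walk I A v u
  reverse-walk sym-A {u} iu w = go iu w here
    where
    go : ∀ {x v} → I x → Walk I A x v → Walk I A x u → Walk I A v u
    go ix here back = back
    go ix (step a iy rest) back = go iy rest (step (sym-A a) ix back)

  triangle : ∀ {u v w} → I u → I v → I w → u ≢ v → u ≢ w → v ≢ w →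
    A u v → A v w → A w u → IsCycle I A (u ∷ v ∷ w ∷ [])
  triangle iu iv iw u≢v u≢w v≢w uv vw wu =
    s≤s (s≤s z≤n) , (iu ∷ iv ∷ iw ∷ []) ,
    ((u≢v ∷ u≢w ∷ []) ∷ (v≢w ∷ []) ∷ [] ∷ []) , (uv ∷ vw ∷ wu ∷ [-])

  square : ∀ {u v w x} → I u → I v → I w → I x →
    u ≢ v → u ≢ w → u ≢ x → v ≢ w → v ≢ x → w ≢ x →
    A u v → A v w → A w x → A x u → IsCycle I A (u ∷ v ∷ w ∷ x ∷ [])
  square iu iv iw ix u≢v u≢w u≢x v≢w v≢x w≢x uv vw wx xu =
    s≤s (s≤s z≤n) , (iu ∷ iv ∷ iw ∷ ix ∷ []) ,
    ((u≢v ∷ u≢w ∷ u≢x ∷ []) ∷ (v≢w ∷ v≢x ∷ []) ∷ (w≢x ∷ []) ∷ [] ∷ []) ,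
    (uv ∷ vw ∷ wx ∷ xu ∷ [-])

  restrict : ∀ {S : V → Set} cs → IsCycle I A cs → All S cs → IsCycle (λ v → I v × S v) A cs
  restrict (c ∷ cs) (len , inside , unique , linked) s =
    len , All.zip (inside , s) , unique , linked

  linked-split : ∀ xs {y ys} → Linked A (xs ++ y ∷ ys) → Linked A (xs ∷ʳ y) × Linked A (y ∷ ys)
  linked-split [] ys = [-] , ys
  linked-split (x ∷ []) (r ∷ ys) = (r ∷ [-]) , ys
  linked-split (x ∷ x′ ∷ xs) (r ∷ rest) with linked-split (x′ ∷ xs) rest
  ... | front , back = (r ∷ front) , back

  linked-join : ∀ xs {y ys} → Linked A (xs ∷ʳ y) → Linked A (y ∷ ys) → Linked A (xs ++ y ∷ ys)
  linked-join [] front back = back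
  linked-join (x ∷ []) (r ∷ _) back = r ∷ back
  linked-join (x ∷ x′ ∷ xs) (r ∷ front) back = r ∷ linked-join (x′ ∷ xs) front back

  rotate : ∀ pre x post → IsCycle I A (pre ++ x ∷ post) → IsCycle I A (x ∷ post ++ pre)
  rotate [] x post cyc = subst (IsCycle I A) (cong (x ∷_) (sym (++-identityʳ post))) cyc
  rotate (p ∷ pre) x post (len , inside , unique , linked) =
    subst (2 ℕ.≤_) (ℕ.suc-injective (↭-length σ)) len ,
    All-resp-↭ σ inside ,
    SetoidPermutation.Unique-resp-↭ (setoid V) (↭⇒↭ₛ σ) unique ,
    subst (Linked A) (sym (++-assoc (x ∷ post) (p ∷ pre) (x ∷ []))) (linked-join (x ∷ post) back front)
    where
    σ : (p ∷ pre) ++ x ∷ post ↭ (x ∷ post) ++ p ∷ pre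
    σ = ++-comm (p ∷ pre) (x ∷ post)
    halves : Linked A ((p ∷ pre) ∷ʳ x) × Linked A (x ∷ post ∷ʳ p)
    halves = linked-split (p ∷ pre) (subst (Linked A) (++-assoc (p ∷ pre) (x ∷ post) (p ∷ [])) linked)
    front : Linked A ((p ∷ pre) ∷ʳ x)
    front = proj₁ halves
    back : Linked A (x ∷ post ∷ʳ p)
    back = proj₂ halves

ShadedShape : ℕ × ℕ → Set
ShadedShape (a , b) = (a ℕ.≤ 2 × b ℕ.≤ 1) ⊎ (3 ℕ.≤ a × 2 ℕ.≤ b)

R-m-shape : All ShadedShape R-m
R-m-shape = toWitness {a? = All.all? shape? R-m} _
  where
  shape? : ∀ ab → Dec (ShadedShape ab)
  shape? (a , b) = (a ℕ.≤? 2 ×-dec b ℕ.≤? 1) ⊎-dec (3 ℕ.≤? a ×-dec 2 ℕ.≤? b)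

lower-left-shaded : ∀ (a : Fin 3) (b : Fin 2) → (toℕ a , toℕ b) ∈ R-m
lower-left-shaded = toWitness {a? = all? λ a → all? λ b → (toℕ a , toℕ b) ∈? R-m} _

upper-right-shaded : ∀ (a : Fin 2) (b : Fin 3) → (3 + toℕ a , 2 + toℕ b) ∈ R-m
upper-right-shaded = toWitness {a? = all? λ a → all? λ b → (3 + toℕ a , 2 + toℕ b) ∈? R-m} _

module Occurrences {n : ℕ} (π : Permutation′ n) where

  P : Fin n → Fin n
  P i = π ⟨$⟩ʳ i

  P-injective : ∀ {i j} → P i ≡ P j → i ≡ j
  P-injective e = trans (sym (inverseˡ π)) (trans (cong (π ⟨$⟩ˡ_) e) (inverseˡ π))

  not-ascending : ∀ {x y} → x ≢ y → ¬ P x < P y → P y < P x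
  not-ascending {x} {y} x≢y ¬Px<Py with <-cmp (P x) (P y)
  ... | tri< Px<Py _ _ = ⊥-elim (¬Px<Py Px<Py)
  ... | tri≈ _ Px≡Py _ = ⊥-elim (x≢y (P-injective Px≡Py))
  ... | tri> _ _ Py<Px = Py<Px

  -- An involutive pattern τ occurs at ι as soon as the positions ascend and the values
  -- ascend in the order ι(τ 0), ι(τ 1), …  (for an involution, τ v is the index carrying
  -- the v-th smallest value).  All patterns of the theorem are involutions, which the
  -- implicit argument checks by evaluation.
  occurrence : ∀ {k} (τ : Fin (suc k) → Fin (suc k)) {involution : True (all? λ x → τ (τ x) ≟ x)}
    {ι : Fin (suc k) → Fin n} → Ascending ι → Ascending (P ∘ ι ∘ τ) → Occurrence π τ ι
  occurrence τ {involution} {ι} positions values = ascending⇒increasing ι positions , order-iso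
    where
    ττ : ∀ x → τ (τ x) ≡ x
    ττ = toWitness involution

    preserves : ∀ a b → τ a < τ b → P (ι a) < P (ι b)
    preserves a b τa<τb = subst₂ (λ x y → P (ι x) < P (ι y)) (ττ a) (ττ b)
      (ascending⇒increasing (P ∘ ι ∘ τ) values (τ a) (τ b) τa<τb)

    reflects : ∀ a b → P (ι a) < P (ι b) → τ a < τ b
    reflects a b Pa<Pb with <-cmp (τ a) (τ b)
    ... | tri< τa<τb _ _ = τa<τb
    ... | tri≈ _ τa≡τb _ =
      ⊥-elim (<-irrefl (cong (P ∘ ι) (trans (sym (ττ a)) (trans (cong τ τa≡τb) (ττ b)))) Pa<Pb)
    ... | tri> _ _ τb<τa = ⊥-elim (<-asym Pa<Pb (preserves b a τb<τa))

    order-iso : OrderIso π ι τ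
    order-iso a b = reflects a b , preserves a b

  module _ {k} {τ : Fin k → Fin k} {ι : Fin k → Fin n} (occ : Occurrence π τ ι) where

    position< : (a b : Fin k) {a<b : True (a <? b)} → ι a < ι b
    position< a b {a<b} = proj₁ occ a b (toWitness a<b)

    value< : (a b : Fin k) {τa<τb : True (τ a <? τ b)} → P (ι a) < P (ι b)
    value< a b {τa<τb} = proj₂ (proj₂ occ a b) (toWitness τa<τb)

  contains-12 : ∀ {i j} → i < j → P i < P j → Contains π p12
  contains-12 {i} {j} i<j Pi<Pj =
    lookup (i ∷ j ∷ []) , occurrence p12 (ascending₂ i<j) (ascending₂ Pi<Pj)

  contains-123 : ∀ {i j k} → i < j → j < k → P i < P j → P j < P k → Contains π p123
  contains-123 {i} {j} {k} i<j j<k Pi<Pj Pj<Pk =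
    lookup (i ∷ j ∷ k ∷ []) , occurrence p123 (ascending₃ i<j j<k) (ascending₃ Pi<Pj Pj<Pk)

  contains-1432 : ∀ {a b c d} → a < b → b < c → c < d →
    P a < P d → P d < P c → P c < P b → Contains π p1432
  contains-1432 {a} {b} {c} {d} a<b b<c c<d Pa<Pd Pd<Pc Pc<Pb =
    lookup (a ∷ b ∷ c ∷ d ∷ []) ,
    occurrence p1432 (ascending₄ a<b b<c c<d) (ascending₄ Pa<Pd Pd<Pc Pc<Pb)

  contains-2143 : ∀ {a b c d} → a < b → b < c → c < d →
    P b < P a → P a < P d → P d < P c → Contains π p2143
  contains-2143 {a} {b} {c} {d} a<b b<c c<d Pb<Pa Pa<Pd Pd<Pc =
    lookup (a ∷ b ∷ c ∷ d ∷ []) ,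
    occurrence p2143 (ascending₄ a<b b<c c<d) (ascending₄ Pb<Pa Pa<Pd Pd<Pc)

  contains-3214 : ∀ {a b c d} → a < b → b < c → c < d →
    P c < P b → P b < P a → P a < P d → Contains π p3214
  contains-3214 {a} {b} {c} {d} a<b b<c c<d Pc<Pb Pb<Pa Pa<Pd =
    lookup (a ∷ b ∷ c ∷ d ∷ []) ,
    occurrence p3214 (ascending₄ a<b b<c c<d) (ascending₄ Pc<Pb Pb<Pa Pa<Pd)

  occurrence-3412 : ∀ {l r c d} → l < r → r < c → c < d →
    P c < P d → P d < P l → P l < P r → Occurrence π p3412 (lookup (l ∷ r ∷ c ∷ d ∷ []))
  occurrence-3412 l<r r<c c<d Pc<Pd Pd<Pl Pl<Pr =
    occurrence p3412 (ascending₄ l<r r<c c<d) (ascending₄ Pc<Pd Pd<Pl Pl<Pr)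

  Vertex : Set
  Vertex = Fin n × Fin n

  V : Vertex → Set
  V = V₁₂ π

  _~_ : Vertex → Vertex → Set
  _~_ = Adj₁₂ π

  same-left : ∀ {i j l} → j ≢ l → (i , j) ~ (i , l)
  same-left j≢l = inj₁ refl , j≢l ∘ proj₂

  same-right : ∀ {i j k} → i ≢ k → (i , j) ~ (k , j)
  same-right i≢k = inj₂ (inj₂ (inj₂ refl)) , i≢k ∘ proj₁

  consecutive : ∀ {i j l} → i ≢ j → (i , j) ~ (j , l)
  consecutive i≢j = inj₂ (inj₂ (inj₁ refl)) , i≢j ∘ proj₁

  ~-sym : ∀ {u w} → u ~ w → w ~ u
  ~-sym {i , j} {k , l} (shared , distinct) = swap shared , λ (e , e′) → distinct (sym e , sym e′)
    where
    swap : i ≡ k ⊎ i ≡ l ⊎ j ≡ k ⊎ j ≡ l → k ≡ i ⊎ k ≡ j ⊎ l ≡ i ⊎ l ≡ j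
    swap (inj₁ i≡k) = inj₁ (sym i≡k)
    swap (inj₂ (inj₁ i≡l)) = inj₂ (inj₂ (inj₁ (sym i≡l)))
    swap (inj₂ (inj₂ (inj₁ j≡k))) = inj₂ (inj₁ (sym j≡k))
    swap (inj₂ (inj₂ (inj₂ j≡l))) = inj₂ (inj₂ (inj₂ (sym j≡l)))

  open Graphs V _~_ using (walk-preserves; triangle; square)

  increasing-triangle : ∀ {i j k} → i < j → j < k → P i < P j → P j < P k →
    IsCycle V _~_ ((i , j) ∷ (j , k) ∷ (i , k) ∷ [])
  increasing-triangle i<j j<k Pi<Pj Pj<Pk =
    triangle (i<j , Pi<Pj) (j<k , Pj<Pk) (<-trans i<j j<k , <-trans Pi<Pj Pj<Pk)
      (<⇒≢ i<j ∘ cong proj₁) (<⇒≢ j<k ∘ cong proj₂) (<⇒≢ i<j ∘ sym ∘ cong proj₁)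
      (consecutive (<⇒≢ i<j)) (same-right (<⇒≢ i<j ∘ sym)) (same-left (<⇒≢ j<k ∘ sym))

  left-claw : ∀ {a b c d} → b < c → c < d → V (a , b) → V (a , c) → V (a , d) →
    IsCycle V _~_ ((a , b) ∷ (a , c) ∷ (a , d) ∷ [])
  left-claw b<c c<d ab ac ad =
    triangle ab ac ad
      (<⇒≢ b<c ∘ cong proj₂) (<⇒≢ (<-trans b<c c<d) ∘ cong proj₂) (<⇒≢ c<d ∘ cong proj₂)
      (same-left (<⇒≢ b<c)) (same-left (<⇒≢ c<d)) (same-left (<⇒≢ (<-trans b<c c<d) ∘ sym))

  right-claw : ∀ {a b c d} → a < b → b < c → V (a , d) → V (b , d) → V (c , d) →
    IsCycle V _~_ ((a , d) ∷ (b , d) ∷ (c , d) ∷ [])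
  right-claw a<b b<c ad bd cd =
    triangle ad bd cd
      (<⇒≢ a<b ∘ cong proj₁) (<⇒≢ (<-trans a<b b<c) ∘ cong proj₁) (<⇒≢ b<c ∘ cong proj₁)
      (same-right (<⇒≢ a<b)) (same-right (<⇒≢ b<c)) (same-right (<⇒≢ (<-trans a<b b<c) ∘ sym))

  crossing-square : ∀ {a b c d} → a < b → c < d →
    V (a , c) → V (a , d) → V (b , d) → V (b , c) →
    IsCycle V _~_ ((a , c) ∷ (a , d) ∷ (b , d) ∷ (b , c) ∷ [])
  crossing-square {a} {b} {c} {d} a<b c<d ac ad bd bc =
    square ac ad bd bc
      (c≢d ∘ cong proj₂) (a≢b ∘ cong proj₁) (a≢b ∘ cong proj₁)
      (a≢b ∘ cong proj₁) (a≢b ∘ cong proj₁) (c≢d ∘ sym ∘ cong proj₂)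
      (same-left c≢d) (same-right a≢b) (same-left (c≢d ∘ sym)) (same-right (a≢b ∘ sym))
    where
    a≢b : a ≢ b
    a≢b = <⇒≢ a<b
    c≢d : c ≢ d
    c≢d = <⇒≢ c<d

  module Boxes {k} {τ : Fin k → Fin k} {ι : Fin k → Fin n} (occ : Occurrence π τ ι) where

    position-≤ : ∀ {i j} → toℕ i ℕ.≤ toℕ j → ι i ≤ ι j
    position-≤ {i} {j} i≤j with ℕ.m≤n⇒m<n∨m≡n i≤j
    ... | inj₁ i<j = ℕ.<⇒≤ (proj₁ occ i j i<j)
    ... | inj₂ i≡j = ℕ.≤-reflexive (cong (toℕ ∘ ι) (toℕ-injective i≡j))

    value-≤ : ∀ {i j} → toℕ (τ i) ℕ.≤ toℕ (τ j) → P (ι i) ≤ P (ι j)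
    value-≤ {i} {j} τi≤τj = ℕ.≮⇒≥ λ Pj<Pi → ℕ.<⇒≱ (proj₁ (proj₂ occ j i) Pj<Pi) τi≤τj

    left-of : ∀ {a x} (j : Fin k) → a ℕ.≤ toℕ j → LeftOf π τ ι a x → x < ι j
    left-of j a≤j (inj₁ refl) = ⊥-elim (ℕ.<⇒≱ (toℕ<n j) a≤j)
    left-of j a≤j (inj₂ (i , refl , x<ιi)) = ℕ.<-≤-trans x<ιi (position-≤ a≤j)

    right-of : ∀ {a x} (j : Fin k) → toℕ j ℕ.< a → RightOf π τ ι a x → ι j < x
    right-of j j<a (inj₁ refl) = ⊥-elim (ℕ.n≮0 j<a)
    right-of j j<a (inj₂ (i , refl , ιi<x)) = ℕ.≤-<-trans (position-≤ (ℕ.≤-pred j<a)) ιi<x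

    below : ∀ {b x} (j : Fin k) → b ℕ.≤ toℕ (τ j) → Below π τ ι b x → P x < P (ι j)
    below j b≤τj (inj₁ refl) = ⊥-elim (ℕ.<⇒≱ (toℕ<n (τ j)) b≤τj)
    below j b≤τj (inj₂ (i , refl , Px<Pιi)) = ℕ.<-≤-trans Px<Pιi (value-≤ b≤τj)

    above : ∀ {b x} (j : Fin k) → toℕ (τ j) ℕ.< b → Above π τ ι b x → P (ι j) < P x
    above j τj<b (inj₁ refl) = ⊥-elim (ℕ.n≮0 τj<b)
    above j τj<b (inj₂ (i , refl , Pιi<Px)) = ℕ.≤-<-trans (value-≤ (ℕ.≤-pred τj<b)) Pιi<Px

  Isolated : Fin n → Fin n → Set
  Isolated c d = (∀ x → x < c → P x < P d → ⊥) × (∀ x → c < x → P d < P x → ⊥)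

  module Occurrence3412 {ι : Fin 4 → Fin n} (occ : Occurrence π p3412 ι) where
    open Boxes occ

    l r c d : Fin n
    l = ι (# 0)
    r = ι (# 1)
    c = ι (# 2)
    d = ι (# 3)

    l<r : l < r
    l<r = position< occ (# 0) (# 1)
    l<c : l < c
    l<c = position< occ (# 0) (# 2)
    r<c : r < c
    r<c = position< occ (# 1) (# 2)
    c<d : c < d
    c<d = position< occ (# 2) (# 3)
    Pc<Pd : P c < P d
    Pc<Pd = value< occ (# 2) (# 3)
    Pd<Pl : P d < P l
    Pd<Pl = value< occ (# 3) (# 0)
    Pd<Pr : P d < P r
    Pd<Pr = value< occ (# 3) (# 1)
    Pl<Pr : P l < P r
    Pl<Pr = value< occ (# 0) (# 1)

    lower-column : ∀ {x} → x < c → P x < P d →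
      Σ (Fin 3) λ a → RightOf π p3412 ι (toℕ a) x × LeftOf π p3412 ι (toℕ a) x
    lower-column {x} x<c Px<Pd with <-cmp x l
    ... | tri< x<l _ _ = # 0 , inj₁ refl , inj₂ (# 0 , refl , x<l)
    ... | tri≈ _ refl _ = ⊥-elim (<-asym Px<Pd Pd<Pl)
    ... | tri> _ _ l<x with <-cmp x r
    ...   | tri< x<r _ _ = # 1 , inj₂ (# 0 , refl , l<x) , inj₂ (# 1 , refl , x<r)
    ...   | tri≈ _ refl _ = ⊥-elim (<-asym Px<Pd Pd<Pr)
    ...   | tri> _ _ r<x = # 2 , inj₂ (# 1 , refl , r<x) , inj₂ (# 2 , refl , x<c)

    lower-row : ∀ {x} → x < c → P x < P d →
      Σ (Fin 2) λ b → Above π p3412 ι (toℕ b) x × Below π p3412 ι (toℕ b) x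
    lower-row {x} x<c Px<Pd with <-cmp (P x) (P c)
    ... | tri< Px<Pc _ _ = # 0 , inj₁ refl , inj₂ (# 2 , refl , Px<Pc)
    ... | tri≈ _ Px≡Pc _ = ⊥-elim (<⇒≢ x<c (P-injective Px≡Pc))
    ... | tri> _ _ Pc<Px = # 1 , inj₂ (# 2 , refl , Pc<Px) , inj₂ (# 3 , refl , Px<Pd)

    upper-column : ∀ {x} → c < x → P d < P x →
      Σ (Fin 2) λ a → RightOf π p3412 ι (3 + toℕ a) x × LeftOf π p3412 ι (3 + toℕ a) x
    upper-column {x} c<x Pd<Px with <-cmp x d
    ... | tri< x<d _ _ = # 0 , inj₂ (# 2 , refl , c<x) , inj₂ (# 3 , refl , x<d)
    ... | tri≈ _ refl _ = ⊥-elim (<-irrefl refl Pd<Px)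
    ... | tri> _ _ d<x = # 1 , inj₂ (# 3 , refl , d<x) , inj₁ refl

    upper-row : ∀ {x} → c < x → P d < P x →
      Σ (Fin 3) λ b → Above π p3412 ι (2 + toℕ b) x × Below π p3412 ι (2 + toℕ b) x
    upper-row {x} c<x Pd<Px with <-cmp (P x) (P l)
    ... | tri< Px<Pl _ _ = # 0 , inj₂ (# 3 , refl , Pd<Px) , inj₂ (# 0 , refl , Px<Pl)
    ... | tri≈ _ Px≡Pl _ = ⊥-elim (<-asym l<c (subst (c <_) (P-injective Px≡Pl) c<x))
    ... | tri> _ _ Pl<Px with <-cmp (P x) (P r)
    ...   | tri< Px<Pr _ _ = # 1 , inj₂ (# 0 , refl , Pl<Px) , inj₂ (# 1 , refl , Px<Pr)
    ...   | tri≈ _ Px≡Pr _ = ⊥-elim (<-asym r<c (subst (c <_) (P-injective Px≡Pr) c<x))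
    ...   | tri> _ _ Pr<Px = # 2 , inj₂ (# 1 , refl , Pr<Px) , inj₁ refl

    -- The shaded boxes of m cover exactly the two isolating regions.
    isolated⇒mesh : Isolated c d → ∀ ab → ab ∈ R-m → BoxEmpty π p3412 ι ab
    isolated⇒mesh (lower , upper) (a , b) shaded (x , right , left , over , under)
      with All.lookup R-m-shape shaded
    ... | inj₁ (a≤2 , b≤1) = lower x (left-of (# 2) a≤2 left) (below (# 3) b≤1 under)
    ... | inj₂ (3≤a , 2≤b) = upper x (right-of (# 2) 3≤a right) (above (# 3) 2≤b over)

    mesh⇒isolated : (∀ ab → ab ∈ R-m → BoxEmpty π p3412 ι ab) → Isolated c d
    mesh⇒isolated boxes = lower , upper
      where
      lower : ∀ x → x < c → P x < P d → ⊥
      lower x x<c Px<Pd with lower-column x<c Px<Pd | lower-row x<c Px<Pd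
      ... | a , right , left | b , over , under =
        boxes _ (lower-left-shaded a b) (x , right , left , over , under)

      upper : ∀ x → c < x → P d < P x → ⊥
      upper x c<x Pd<Px with upper-column c<x Pd<Px | upper-row c<x Pd<Px
      ... | a , right , left | b , over , under =
        boxes _ (upper-right-shaded a b) (x , right , left , over , under)

    -- An isolated occurrence separates the vertex (c , d) from (l , r): the vertices with
    -- both endpoints in the quadrant {x : c ≤ x, P x ≤ P d} are closed under adjacency.
    separated : Isolated c d → ¬ Walk V _~_ (c , d) (l , r)
    separated (lower , upper) walk =
      ℕ.<⇒≱ l<c (proj₁ (proj₁ (walk-preserves Inside² step-inside walk start)))
      where
      Inside : Fin n → Set
      Inside x = c ≤ x × P x ≤ P d

      Inside² : Vertex → Set
      Inside² (i , j) = Inside i × Inside j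

      start : Inside² (c , d)
      start = (ℕ.≤-refl , ℕ.<⇒≤ Pc<Pd) , (ℕ.<⇒≤ c<d , ℕ.≤-refl)

      right-inside : ∀ {i j} → V (i , j) → Inside i → Inside j
      right-inside {i} {j} (i<j , _) (c≤i , _) = ℕ.<⇒≤ c<j , ℕ.≮⇒≥ (upper j c<j)
        where
        c<j : c < j
        c<j = ℕ.≤-<-trans c≤i i<j

      left-inside : ∀ {i j} → V (i , j) → Inside j → Inside i
      left-inside {i} {j} (_ , Pi<Pj) (_ , Pj≤Pd) = ℕ.≮⇒≥ (λ i<c → lower i i<c Pi<Pd) , ℕ.<⇒≤ Pi<Pd
        where
        Pi<Pd : P i < P d
        Pi<Pd = ℕ.<-≤-trans Pi<Pj Pj≤Pd

      step-inside : ∀ {u w} → u ~ w → V w → Inside² u → Inside² w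
      step-inside (inj₁ refl , _) w (inside , _) = inside , right-inside w inside
      step-inside (inj₂ (inj₁ refl) , _) w (inside , _) = left-inside w inside , inside
      step-inside (inj₂ (inj₂ (inj₁ refl)) , _) w (_ , inside) = inside , right-inside w inside
      step-inside (inj₂ (inj₂ (inj₂ refl)) , _) w (_ , inside) = left-inside w inside , inside

module TreeConditions {n : ℕ} (π : Permutation′ n) (tree : G₁₂-isTree π) where
  open Occurrences π

  connected : Connected V _~_
  connected = proj₁ (proj₂ tree)

  acyclic : Acyclic V _~_
  acyclic = proj₂ (proj₂ tree)

  avoids-123 : Avoids π p123
  avoids-123 (ι , occ) = acyclic _
    (increasing-triangle (position< occ (# 0) (# 1)) (position< occ (# 1) (# 2))
      (value< occ (# 0) (# 1)) (value< occ (# 1) (# 2)))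

  avoids-1432 : Avoids π p1432
  avoids-1432 (ι , occ) = acyclic _
    (left-claw (position< occ (# 1) (# 2)) (position< occ (# 2) (# 3))
      (position< occ (# 0) (# 1) , value< occ (# 0) (# 1))
      (position< occ (# 0) (# 2) , value< occ (# 0) (# 2))
      (position< occ (# 0) (# 3) , value< occ (# 0) (# 3)))

  avoids-3214 : Avoids π p3214
  avoids-3214 (ι , occ) = acyclic _
    (right-claw (position< occ (# 0) (# 1)) (position< occ (# 1) (# 2))
      (position< occ (# 0) (# 3) , value< occ (# 0) (# 3))
      (position< occ (# 1) (# 3) , value< occ (# 1) (# 3))
      (position< occ (# 2) (# 3) , value< occ (# 2) (# 3)))

  avoids-2143 : Avoids π p2143
  avoids-2143 (ι , occ) = acyclic _
    (crossing-square (position< occ (# 0) (# 1)) (position< occ (# 2) (# 3))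
      (position< occ (# 0) (# 2) , value< occ (# 0) (# 2))
      (position< occ (# 0) (# 3) , value< occ (# 0) (# 3))
      (position< occ (# 1) (# 3) , value< occ (# 1) (# 3))
      (position< occ (# 1) (# 2) , value< occ (# 1) (# 2)))

  avoids-m : AvoidsMesh π p3412 R-m
  avoids-m (ι , occ , boxes) =
    separated (mesh⇒isolated boxes) (connected _ _ (c<d , Pc<Pd) (l<r , Pl<Pr))
    where open Occurrence3412 occ

  not-avoids-12 : ¬ Avoids π p12
  not-avoids-12 avoids with proj₁ tree
  ... | _ , i<j , Pi<Pj = avoids (contains-12 i<j Pi<Pj)

module PatternConditions {n : ℕ} (π : Permutation′ n)
  (avoids-123 : Avoids π p123) (avoids-1432 : Avoids π p1432) (avoids-2143 : Avoids π p2143)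
  (avoids-3214 : Avoids π p3214) (avoids-m : AvoidsMesh π p3412 R-m) where
  open Occurrences π
  open Graphs V _~_ using (restrict; reverse-walk)

  no-middle : ∀ {i j k} → V (i , j) → V (k , i) → ⊥
  no-middle (i<j , Pi<Pj) (k<i , Pk<Pi) = avoids-123 (contains-123 k<i i<j Pk<Pi Pi<Pj)

  before-left-end : ∀ {h i j} → h < i → V (i , j) → P i < P h
  before-left-end h<i (i<j , Pi<Pj) =
    not-ascending (<⇒≢ h<i) λ Ph<Pi → avoids-123 (contains-123 h<i i<j Ph<Pi Pi<Pj)

  after-right-end : ∀ {i j k} → j < k → V (i , j) → P k < P j
  after-right-end j<k (i<j , Pi<Pj) =
    not-ascending (<⇒≢ j<k) λ Pj<Pk → avoids-123 (contains-123 i<j j<k Pi<Pj Pj<Pk)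

  ShareLeft ShareRight : Vertex → Vertex → Set
  ShareLeft u w = proj₁ u ≡ proj₁ w × proj₂ u ≢ proj₂ w
  ShareRight u w = proj₂ u ≡ proj₂ w × proj₁ u ≢ proj₁ w

  shares-end : ∀ {u w} → V u → V w → u ~ w → ShareLeft u w ⊎ ShareRight u w
  shares-end _ _ (inj₁ i≡k , distinct) = inj₁ (i≡k , λ j≡l → distinct (i≡k , j≡l))
  shares-end vu vw (inj₂ (inj₁ refl) , _) = ⊥-elim (no-middle vu vw)
  shares-end vu vw (inj₂ (inj₂ (inj₁ refl)) , _) = ⊥-elim (no-middle vw vu)
  shares-end _ _ (inj₂ (inj₂ (inj₂ j≡l)) , distinct) = inj₂ (j≡l , λ i≡k → distinct (i≡k , j≡l))

  no-three-lefts : ∀ {i x y z} → x ≢ y → y ≢ z → x ≢ z → V (i , x) → V (i , y) → V (i , z) → ⊥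
  no-three-lefts {i} = no-three {Q = λ x → V (i , x)} λ a<b b<c ia@(i<a , _) ib (_ , Pi<Pc) →
    avoids-1432 (contains-1432 i<a a<b b<c Pi<Pc (after-right-end b<c ib) (after-right-end a<b ia))

  no-three-rights : ∀ {j x y z} → x ≢ y → y ≢ z → x ≢ z → V (x , j) → V (y , j) → V (z , j) → ⊥
  no-three-rights {j} = no-three {Q = λ x → V (x , j)} λ a<b b<c (_ , Pa<Pj) bj cj@(c<j , _) →
    avoids-3214 (contains-3214 a<b b<c c<j (before-left-end b<c cj) (before-left-end a<b bj) Pa<Pj)

  alternate : ∀ {u v w} → V u → V v → V w → u ~ v → v ~ w → u ≢ w →
    (ShareLeft u v × ShareRight v w) ⊎ (ShareRight u v × ShareLeft v w)
  alternate vu vv vw u~v v~w u≢w with shares-end vu vv u~v | shares-end vv vw v~w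
  ... | inj₁ (refl , j≢l) | inj₁ (refl , l≢q) =
    ⊥-elim (no-three-lefts j≢l l≢q (λ j≡q → u≢w (cong₂ _,_ refl j≡q)) vu vv vw)
  ... | inj₁ left | inj₂ right = inj₁ (left , right)
  ... | inj₂ right | inj₁ left = inj₂ (right , left)
  ... | inj₂ (refl , i≢k) | inj₂ (refl , k≢p) =
    ⊥-elim (no-three-rights i≢k k≢p (λ i≡p → u≢w (cong₂ _,_ i≡p refl)) vu vv vw)

  -- The obstruction to cycles: a path a ~ b ~ c ~ d (a ≢ c, b ≢ d) in which b and c share
  -- a right end r bounding the right ends of a and d.  Then a, b share their left end x,
  -- c, d share their left end y, and x, y, the right end of a or d, and r form 2143.
  no-square : ∀ {a b c d} → V a → V b → V c → V d → a ~ b → b ~ c → c ~ d → a ≢ c → b ≢ d →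
    proj₂ b ≡ proj₂ c → proj₂ a ≤ proj₂ b → proj₂ d ≤ proj₂ b → ⊥
  no-square {b = b} {c} va vb vc vd a~b b~c c~d a≢c b≢d refl a≤b d≤b
    with alternate va vb vc a~b b~c a≢c | alternate vb vc vd b~c c~d b≢d
  ... | inj₂ (_ , (_ , r≢r)) | _ = r≢r refl
  ... | inj₁ _ | inj₁ ((_ , r≢r) , _) = r≢r refl
  ... | inj₁ ((refl , a≢r) , _) | inj₂ (_ , (refl , r≢d)) with <-cmp (proj₁ b) (proj₁ c)
  ...   | tri< x<y _ _ = avoids-2143 (contains-2143 x<y (proj₁ vd) (≤∧≢⇒< d≤b (r≢d ∘ sym))
          (before-left-end x<y vc) (proj₂ vb) (after-right-end (≤∧≢⇒< d≤b (r≢d ∘ sym)) vd))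
  ...   | tri≈ _ x≡y _ = proj₂ b~c (x≡y , refl)
  ...   | tri> _ _ y<x = avoids-2143 (contains-2143 y<x (proj₁ va) (≤∧≢⇒< a≤b a≢r)
          (before-left-end y<x vb) (proj₂ vc) (after-right-end (≤∧≢⇒< a≤b a≢r) va))

  Bounded : Fin n → Vertex → Set
  Bounded r u = V u × proj₂ u ≤ r

  no-cycle-at-max : ∀ {r a b c} rest → IsCycle (Bounded r) _~_ (a ∷ b ∷ c ∷ rest) →
    proj₂ b ≡ r → proj₂ b ≡ proj₂ c → ⊥
  no-cycle-at-max [] (_ , (va ∷ vb ∷ vc ∷ []) , ((a≢b ∷ a≢c ∷ []) ∷ _) , (a~b ∷ b~c ∷ c~a ∷ [-]))
    refl shared =
    no-square (proj₁ va) (proj₁ vb) (proj₁ vc) (proj₁ va) a~b b~c c~a a≢c (a≢b ∘ sym)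
      shared (proj₂ va) (proj₂ va)
  no-cycle-at-max (d ∷ rest)
    (_ , (va ∷ vb ∷ vc ∷ vd ∷ _) , ((_ ∷ a≢c ∷ _) ∷ (_ ∷ b≢d ∷ _) ∷ _) , (a~b ∷ b~c ∷ c~d ∷ _))
    refl shared =
    no-square (proj₁ va) (proj₁ vb) (proj₁ vc) (proj₁ vd) a~b b~c c~d a≢c b≢d
      shared (proj₂ va) (proj₂ vd)

  -- Read the cycle from the predecessor p of a vertex m of maximal right end.  If m shares
  -- its right end with its successor, the cycle is p m …; if it shares it with p, it is
  -- read once more from the predecessor of p.
  from-second-predecessor : ∀ {p m} ys → IsCycle (Bounded (proj₂ m)) _~_ (p ∷ m ∷ ys) →
    proj₂ p ≡ proj₂ m → ⊥
  from-second-predecessor ys cycle shared with initLast ys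
  from-second-predecessor .[] (s≤s () , _) shared | []
  from-second-predecessor .(ws ∷ʳ q) cycle shared | ws ∷ʳ′ q =
    no-cycle-at-max ws (Graphs.rotate (Bounded _) _~_ (_ ∷ _ ∷ ws) q [] cycle) shared shared

  from-predecessor : ∀ {p m} zs → IsCycle (Bounded (proj₂ m)) _~_ (p ∷ m ∷ zs) → ⊥
  from-predecessor [] (s≤s () , _)
  from-predecessor (z ∷ zs) cycle@(_ , (vp ∷ vm ∷ vz ∷ _) , ((_ ∷ p≢z ∷ _) ∷ _) , (p~m ∷ m~z ∷ _))
    with alternate (proj₁ vp) (proj₁ vm) (proj₁ vz) p~m m~z p≢z
  ... | inj₁ (_ , (shared , _)) = no-cycle-at-max zs cycle refl shared
  ... | inj₂ ((shared , _) , _) = from-second-predecessor (z ∷ zs) cycle shared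

  from-max : ∀ {m} ys → IsCycle (Bounded (proj₂ m)) _~_ (m ∷ ys) → ⊥
  from-max ys cycle with initLast ys
  from-max .[] (() , _) | []
  from-max .(zs ∷ʳ p) cycle | zs ∷ʳ′ p = from-predecessor zs (Graphs.rotate (Bounded _) _~_ (_ ∷ zs) p [] cycle)

  from-member : ∀ {m} cs → m ∈ cs → IsCycle (Bounded (proj₂ m)) _~_ cs → ⊥
  from-member cs m∈cs cycle with ∈-∃++ m∈cs
  ... | pre , post , refl = from-max (post ++ pre) (Graphs.rotate (Bounded _) _~_ pre _ post cycle)

  -- Every cycle has a vertex m of maximal right end, and is a cycle of Bounded (proj₂ m).
  acyclic : Acyclic V _~_
  acyclic [] ()
  acyclic (v ∷ vs) cycle = from-member (v ∷ vs) m∈cycle (restrict (v ∷ vs) cycle maximal)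
    where
    right-end : Vertex → ℕ
    right-end u = toℕ (proj₂ u)

    m : Vertex
    m = argmax right-end v vs

    m∈cycle : m ∈ v ∷ vs
    m∈cycle with argmax-sel right-end v vs
    ... | inj₁ m≡v = here m≡v
    ... | inj₂ m∈vs = there m∈vs

    maximal : All (λ u → proj₂ u ≤ proj₂ m) (v ∷ vs)
    maximal = f[⊥]≤f[argmax] {f = right-end} v vs ∷ f[xs]≤f[argmax] {f = right-end} v vs

  -- The lexicographic order on vertices, along which walks are built.
  _<ₗ_ : Vertex → Vertex → Set
  (i , j) <ₗ (k , l) = i < k ⊎ (i ≡ k × j < l)

  _≤ₗ_ : Vertex → Vertex → Set
  u ≤ₗ v = u ≡ v ⊎ u <ₗ v

  <ₗ-trichotomy : ∀ u v → u <ₗ v ⊎ u ≡ v ⊎ v <ₗ u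
  <ₗ-trichotomy (i , j) (k , l) with <-cmp i k
  ... | tri< i<k _ _ = inj₁ (inj₁ i<k)
  ... | tri> _ _ k<i = inj₂ (inj₂ (inj₁ k<i))
  ... | tri≈ _ refl _ with <-cmp j l
  ...   | tri< j<l _ _ = inj₁ (inj₂ (refl , j<l))
  ...   | tri≈ _ refl _ = inj₂ (inj₁ refl)
  ...   | tri> _ _ l<j = inj₂ (inj₂ (inj₂ (refl , l<j)))

  rank : Vertex → ℕ
  rank (i , j) = toℕ i * n + toℕ j

  rank-mono : ∀ {u v} → u <ₗ v → rank u ℕ.< rank v
  rank-mono {i , j} {k , l} (inj₁ i<k) = begin-strict
    toℕ i * n + toℕ j    <⟨ ℕ.+-monoʳ-< (toℕ i * n) (toℕ<n j) ⟩
    toℕ i * n + n        ≡⟨ ℕ.+-comm (toℕ i * n) n ⟩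
    suc (toℕ i) * n      ≤⟨ ℕ.*-monoˡ-≤ n i<k ⟩
    toℕ k * n            ≤⟨ ℕ.m≤m+n (toℕ k * n) (toℕ l) ⟩
    toℕ k * n + toℕ l    ∎
    where open ℕ.≤-Reasoning
  rank-mono {i , j} (inj₂ (refl , j<l)) = ℕ.+-monoʳ-< (toℕ i * n) j<l

  at-least-left : ∀ {l r} → V (l , r) → (∀ x → l < x → x < r → P r < P x) →
    ∀ x → x ≤ r → P l ≤ P x
  at-least-left {l} {r} vlr between x x≤r with <-cmp x l
  ... | tri< x<l _ _ = ℕ.<⇒≤ (before-left-end x<l vlr)
  ... | tri≈ _ refl _ = ℕ.≤-refl
  ... | tri> _ _ l<x with <-cmp x r
  ...   | tri< x<r _ _ = ℕ.<⇒≤ (<-trans (proj₂ vlr) (between x l<x x<r))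
  ...   | tri≈ _ refl _ = ℕ.<⇒≤ (proj₂ vlr)
  ...   | tri> _ _ r<x = ⊥-elim (ℕ.<⇒≱ r<x x≤r)

  -- Gap configuration: a vertex (l , r), all positions after r below l, all positions
  -- strictly between l and r above r.  An ascent (c , d) after r with c leftmost and d
  -- highest after c then makes l r c d an isolated 3412, i.e. an occurrence of m.
  no-isolated-gap : ∀ {l r c d} → V (l , r) → r < c → c < d → P c < P d →
    (∀ y → r < y → P y < P l) → (∀ x → l < x → x < r → P r < P x) →
    (∀ x → r < x → x < c → ∀ y → x < y → P x < P y → ⊥) → (∀ x → c < x → P x ≤ P d) → ⊥
  no-isolated-gap {l} {r} {c} {d} vlr r<c c<d Pc<Pd after-r between leftmost highest =
    avoids-m (_ , occ , Occurrence3412.isolated⇒mesh occ (lower , upper))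
    where
    Pd<Pl : P d < P l
    Pd<Pl = after-r d (<-trans r<c c<d)

    occ : Occurrence π p3412 (lookup (l ∷ r ∷ c ∷ d ∷ []))
    occ = occurrence-3412 (proj₁ vlr) r<c c<d Pc<Pd Pd<Pl (proj₂ vlr)

    lower : ∀ x → x < c → P x < P d → ⊥
    lower x x<c Px<Pd with ℕ.≤-<-connex (toℕ x) (toℕ r)
    ... | inj₁ x≤r = ℕ.<⇒≱ (<-trans Px<Pd Pd<Pl) (at-least-left vlr between x x≤r)
    ... | inj₂ r<x = leftmost x r<x x<c d (<-trans x<c c<d) Px<Pd

    upper : ∀ x → c < x → P d < P x → ⊥
    upper x c<x = ℕ.≤⇒≯ (highest x c<x)

  starts-ascent-after? : ∀ (r x : Fin n) → Dec (r < x × ∃ λ y → x < y × P x < P y)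
  starts-ascent-after? r x = r <? x ×-dec any? λ y → x <? y ×-dec P x <? P y

  no-ascent-after : ∀ {l r} → V (l , r) →
    (∀ y → r < y → P y < P l) → (∀ x → l < x → x < r → P r < P x) →
    ∀ {c₀ d₀} → r < c₀ → c₀ < d₀ → P c₀ < P d₀ → ⊥
  no-ascent-after {l} {r} vlr after-r between {c₀} {d₀} r<c₀ c₀<d₀ Pc₀<Pd₀
    with minimal-witness (starts-ascent-after? r) toℕ (c₀ , r<c₀ , d₀ , c₀<d₀ , Pc₀<Pd₀)
  ... | c , (r<c , d₁ , c<d₁ , Pc<Pd₁) , leftmost
    with maximal-witness (c <?_) (toℕ ∘ P) (d₁ , c<d₁)
  ... | d , c<d , highest =
    no-isolated-gap vlr r<c c<d (ℕ.<-≤-trans Pc<Pd₁ (highest d₁ c<d₁)) after-r between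
      (λ x r<x x<c y x<y Px<Py → ℕ.<⇒≱ x<c (leftmost x (r<x , y , x<y , Px<Py)))
      highest

  Advance : Vertex → Vertex → Vertex → Set
  Advance u v w = u ~ w × V w × u <ₗ w × w ≤ₗ v

  -- Moving the left end from l to l′ < r: the target (l′ , r) is a vertex since l′ is
  -- below l; r′ < r is excluded as l l′ r′ r would form 2143.
  advance-inside : ∀ {l r l′ r′} → V (l , r) → V (l′ , r′) → l < l′ → l′ < r →
    ∃ (Advance (l , r) (l′ , r′))
  advance-inside {l} {r} {l′} {r′} vlr vl′r′ l<l′ l′<r with <-cmp r r′
  ... | tri< r<r′ _ _ = (l′ , r) , same-right (<⇒≢ l<l′) , vl′r , inj₁ l<l′ , inj₂ (inj₂ (refl , r<r′))
    where
    vl′r : V (l′ , r)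
    vl′r = l′<r , <-trans (before-left-end l<l′ vl′r′) (proj₂ vlr)
  ... | tri≈ _ refl _ = (l′ , r) , same-right (<⇒≢ l<l′) , vl′r′ , inj₁ l<l′ , inj₁ refl
  ... | tri> _ _ r′<r = ⊥-elim (avoids-2143 (contains-2143 l<l′ (proj₁ vl′r′) r′<r
          (before-left-end l<l′ vl′r′) (proj₂ vlr) (after-right-end r′<r vl′r′)))

  -- Crossing a gap r < l′ when every position after r is below l: some x strictly
  -- between l and r is below r, as otherwise the ascent (l′ , r′) contradicts the gap lemma.
  advance-across : ∀ {l r l′ r′} → V (l , r) → V (l′ , r′) → r < l′ →
    (∀ y → r < y → P y < P l) → ∃ (Advance (l , r) (l′ , r′))
  advance-across {l} {r} vlr vl′r′ r<l′ after-r with any? (λ x → l <? x ×-dec x <? r ×-dec P x <? P r)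
  ... | yes (x , l<x , x<r , Px<Pr) =
    (x , r) , same-right (<⇒≢ l<x) , (x<r , Px<Pr) , inj₁ l<x , inj₂ (inj₁ (<-trans x<r r<l′))
  ... | no none-lower = ⊥-elim (no-ascent-after vlr after-r between r<l′ (proj₁ vl′r′) (proj₂ vl′r′))
    where
    between : ∀ x → l < x → x < r → P r < P x
    between x l<x x<r = not-ascending (<⇒≢ x<r) λ Px<Pr → none-lower (x , l<x , x<r , Px<Pr)

  advance-left-end : ∀ {l r l′ r′} → V (l , r) → V (l′ , r′) → l < l′ →
    (∀ y → r < y → P y < P l) → ∃ (Advance (l , r) (l′ , r′))
  advance-left-end {r = r} {l′} vlr vl′r′ l<l′ after-r with <-cmp l′ r
  ... | tri< l′<r _ _ = advance-inside vlr vl′r′ l<l′ l′<r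
  ... | tri≈ _ refl _ = ⊥-elim (no-middle vl′r′ vlr)
  ... | tri> _ _ r<l′ = advance-across vlr vl′r′ r<l′ after-r

  -- From u <ₗ v one can always advance: raise the right end if possible, else move the
  -- left end.
  advance : ∀ {u v} → V u → V v → u <ₗ v → ∃ (Advance u v)
  advance {l , r} {.l , r′} vu vv (inj₂ (refl , r<r′)) =
    (l , r′) , same-left (<⇒≢ r<r′) , vv , inj₂ (refl , r<r′) , inj₁ refl
  advance {l , r} {l′ , r′} vu vv (inj₁ l<l′) with any? (λ y → r <? y ×-dec P l <? P y)
  ... | yes (y , r<y , Pl<Py) =
    (l , y) , same-left (<⇒≢ r<y) , (<-trans (proj₁ vu) r<y , Pl<Py) , inj₂ (refl , r<y) , inj₂ (inj₁ l<l′)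
  ... | no none-higher = advance-left-end vu vv l<l′ after-r
    where
    after-r : ∀ y → r < y → P y < P l
    after-r y r<y = not-ascending (<⇒≢ (<-trans (proj₁ vu) r<y)) λ Pl<Py → none-higher (y , r<y , Pl<Py)

  -- Advancing repeatedly walks from u up to any vertex v ≥ₗ u; the rank bounds the number
  -- of steps.
  walk-up : ∀ fuel {u v} → rank v ℕ.≤ fuel + rank u → V u → V v → u ≤ₗ v → Walk V _~_ u v
  walk-up _ _ _ _ (inj₁ refl) = here
  walk-up zero bound _ _ (inj₂ u<v) = ⊥-elim (ℕ.<⇒≱ (rank-mono u<v) bound)
  walk-up (suc fuel) {u} {v} bound vu vv (inj₂ u<v) with advance vu vv u<v
  ... | w , u~w , vw , u<w , w≤v = step u~w vw (walk-up fuel bound′ vw vv w≤v)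
    where
    open ℕ.≤-Reasoning
    bound′ : rank v ℕ.≤ fuel + rank w
    bound′ = begin
      rank v               ≤⟨ bound ⟩
      suc fuel + rank u    ≡⟨ sym (ℕ.+-suc fuel (rank u)) ⟩
      fuel + suc (rank u)  ≤⟨ ℕ.+-monoʳ-≤ fuel (rank-mono u<w) ⟩
      fuel + rank w        ∎

  connected : Connected V _~_
  connected u v vu vv with <ₗ-trichotomy u v
  ... | inj₁ u<v = walk-up (rank v) (ℕ.m≤m+n (rank v) (rank u)) vu vv (inj₂ u<v)
  ... | inj₂ (inj₁ refl) = here
  ... | inj₂ (inj₂ v<u) =
    reverse-walk ~-sym vv (walk-up (rank u) (ℕ.m≤m+n (rank u) (rank v)) vv vu (inj₂ v<u))

  has-vertex : ¬ Avoids π p12 → ∃ V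
  has-vertex contains-12 with any? (λ i → any? λ j → i <? j ×-dec P i <? P j)
  ... | yes (i , j , vertex) = (i , j) , vertex
  ... | no none = ⊥-elim (contains-12 λ (ι , occ) →
    none (ι (# 0) , ι (# 1) , position< occ (# 0) (# 1) , value< occ (# 0) (# 1)))

  is-tree : ¬ Avoids π p12 → G₁₂-isTree π
  is-tree contains-12 = has-vertex contains-12 , connected , acyclic

corollary6p2 : (n : ℕ) (π : Permutation′ n) →
    G₁₂-isTree π ⇔
      (Avoids π p123 × Avoids π p1432 × Avoids π p2143 × Avoids π p3214
        × AvoidsMesh π p3412 R-m × ¬ Avoids π p12)
corollary6p2 n π = mk⇔ tree⇒conditions conditions⇒tree
  where
  Conditions : Set
  Conditions = Avoids π p123 × Avoids π p1432 × Avoids π p2143 × Avoids π p3214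
    × AvoidsMesh π p3412 R-m × ¬ Avoids π p12

  tree⇒conditions : G₁₂-isTree π → Conditions
  tree⇒conditions tree =
    avoids-123 , avoids-1432 , avoids-2143 , avoids-3214 , avoids-m , not-avoids-12
    where open TreeConditions π tree

  conditions⇒tree : Conditions → G₁₂-isTree π
  conditions⇒tree (a123 , a1432 , a2143 , a3214 , am , not-avoids-12) =
    PatternConditions.is-tree π a123 a1432 a2143 a3214 am not-avoids-12
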